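{- For every basis $\Gamma$, computations $M,N$ of $\lambda_c^u$ and computation type $\tau$: if $\Gamma\vdash M:\tau$ and $M\longrightarrow N$, then $\Gamma\vdash N:\tau$.
   Context: Syntax of $\lambda_c^u$: values $V ::= x\mid \lambda x.M$, computations $M ::= \mathit{unit}\,V\mid M\star V$. One-step reduction $\longrightarrow$ is the closure under all (value/computation) contexts of the rules $\mathit{unit}\,V\star(\lambda x.M)\to M[V/x]$, $M\star\lambda x.\mathit{unit}\,x\to M$, and $(L\star\lambda x.M)\star\lambda y.N\to L\star\lambda x.(M\star\lambda y.N)$ for $x\notin FV(N)$. Types: value types $\delta ::= \alpha\mid \delta\to\tau\mid \delta\wedge\delta\mid \omega_{\mathsf V}$, computation types $\tau ::= T\delta\mid \tau\wedge\tau\mid \omega_{\mathsf C}$. The preorders $\le_{\mathsf V},\le_{\mathsf C}$ are the least preorders such that, for each sort, $\omega$ is top, $\wedge$ is monotone, idempotent and commutative, $\sigma\wedge\sigma'\le\sigma$, and $\sigma\le\sigma',\sigma\le\sigma''\Rightarrow\sigma\le\sigma'\wedge\sigma''$; moreover $\omega_{\mathsf V}\le_{\mathsf V}\omega_{\mathsf V}\to\omega_{\mathsf C}$, $(\delta\to\tau)\wedge(\delta\to\tau')\le_{\mathsf V}\delta\to(\tau\wedge\tau')$, $\delta'\le_{\mathsf V}\delta,\tau\le_{\mathsf C}\tau'\Rightarrow\delta\to\tau\le_{\mathsf V}\delta'\to\tau'$, $T\delta\wedge T\delta'\le_{\mathsf C}T(\delta\wedge\delta')$, $\delta\le_{\mathsf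 V}\delta'\Rightarrow T\delta\le_{\mathsf C}T\delta'$. A basis is a finite set of assumptions $x_i:\delta_i$ with distinct variables. Typing rules: (Ax) $x:\delta\in\Gamma\Rightarrow\Gamma\vdash x:\delta$; ($\to$I) $\Gamma,x:\delta\vdash M:\tau\Rightarrow\Gamma\vdash\lambda x.M:\delta\to\tau$; (unit I) $\Gamma\vdash V:\delta\Rightarrow\Gamma\vdash\mathit{unit}\,V:T\delta$; ($\to$E) $\Gamma\vdash M:T\delta,\ \Gamma\vdash V:\delta\to\tau\Rightarrow\Gamma\vdash M\star V:\tau$; and for each sort: ($\omega$) $\Gamma\vdash P:\omega$; ($\wedge$I) from $\Gamma\vdash P:\sigma$ and $\Gamma\vdash P:\sigma'$ infer $\Gamma\vdash P:\sigma\wedge\sigma'$; ($\le$) from $\Gamma\vdash P:\sigma$ and $\sigma\le\sigma'$ infer $\Gamma\vdash P:\sigma'$. -}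

module Defs where

open import Data.Nat using (ℕ; zero; suc)
open import Data.List using (List; []; _∷_)
open import Data.Maybe using (Maybe; just; nothing)

-- Syntax of λ_c^u (de Bruijn indices; terms need not be closed)

infixl 5 _⋆_

mutual
  data Val : Set where
    var : ℕ → Val
    lam : Comp → Val

  data Comp : Set where
    unit : Val → Comp
    _⋆_  : Comp → Val → Comp

ext : (ℕ → ℕ) → ℕ → ℕ
ext ρ zero    = zero
ext ρ (suc n) = suc (ρ n)

mutual
  renV : (ℕ → ℕ) → Val → Val
  renV ρ (var x) = var (ρ x)
  renV ρ (lam M) = lam (renC (ext ρ) M)

  renC : (ℕ → ℕ) → Comp → Comp
  renC ρ (unit V) = unit (renV ρ V)
  renC ρ (M ⋆ V)  = renC ρ M ⋆ renV ρ V

exts : (ℕ → Val) → ℕ → Val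
exts σ zero    = var zero
exts σ (suc n) = renV suc (σ n)

mutual
  subV : (ℕ → Val) → Val → Val
  subV σ (var x) = σ x
  subV σ (lam M) = lam (subC (exts σ) M)

  subC : (ℕ → Val) → Comp → Comp
  subC σ (unit V) = unit (subV σ V)
  subC σ (M ⋆ V)  = subC σ M ⋆ subV σ V

-- single substitution  M[V/x]  (x = index 0; other free indices drop by one)
single : Val → ℕ → Val
single V zero    = V
single V (suc n) = var n

_[_] : Comp → Val → Comp
M [ V ] = subC (single V) M

infix 4 _⟶_ _⟶v_

mutual
  data _⟶_ : Comp → Comp → Set where
    β     : ∀ {V M} → unit V ⋆ lam M ⟶ M [ V ]
    η     : ∀ {M} → M ⋆ lam (unit (var zero)) ⟶ M
    -- (L ⋆ λx.M) ⋆ λy.N → L ⋆ λx.(M ⋆ λy.N), x ∉ FV(N): N is weakened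
    assoc : ∀ {L M N} →
            (L ⋆ lam M) ⋆ lam N ⟶ L ⋆ lam (M ⋆ lam (renC (ext suc) N))
    ξunit : ∀ {V V'} → V ⟶v V' → unit V ⟶ unit V'
    ξ⋆ˡ   : ∀ {M M' V} → M ⟶ M' → M ⋆ V ⟶ M' ⋆ V
    ξ⋆ʳ   : ∀ {M V V'} → V ⟶v V' → M ⋆ V ⟶ M ⋆ V'

  data _⟶v_ : Val → Val → Set where
    ξlam : ∀ {M M'} → M ⟶ M' → lam M ⟶v lam M'

infixr 7 _⇒_
infixl 6 _∧V_ _∧C_

mutual
  data VType : Set where
    tvar : ℕ → VType
    _⇒_  : VType → CType → VType
    _∧V_ : VType → VType → VType
    ωV   : VType

  data CType : Set where
    T    : VType → CType
    _∧C_ : CType → CType → CType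
    ωC   : CType

infix 4 _≤V_ _≤C_

mutual
  data _≤V_ : VType → VType → Set where
    reflV  : ∀ {δ} → δ ≤V δ
    transV : ∀ {δ δ' δ''} → δ ≤V δ' → δ' ≤V δ'' → δ ≤V δ''
    topV   : ∀ {δ} → δ ≤V ωV
    monoV  : ∀ {δ₁ δ₂ δ₁' δ₂'} → δ₁ ≤V δ₁' → δ₂ ≤V δ₂' → δ₁ ∧V δ₂ ≤V δ₁' ∧V δ₂'
    idemV₁ : ∀ {δ} → δ ∧V δ ≤V δ
    idemV₂ : ∀ {δ} → δ ≤V δ ∧V δ
    commV  : ∀ {δ δ'} → δ ∧V δ' ≤V δ' ∧V δ
    lbV    : ∀ {δ δ'} → δ ∧V δ' ≤V δ
    glbV   : ∀ {δ δ' δ''} → δ ≤V δ' → δ ≤V δ'' → δ ≤V δ' ∧V δ''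
    ω⇒     : ωV ≤V ωV ⇒ ωC
    ⇒∧     : ∀ {δ τ τ'} → (δ ⇒ τ) ∧V (δ ⇒ τ') ≤V δ ⇒ (τ ∧C τ')
    ⇒mono  : ∀ {δ δ' τ τ'} → δ' ≤V δ → τ ≤C τ' → δ ⇒ τ ≤V δ' ⇒ τ'

  data _≤C_ : CType → CType → Set where
    reflC  : ∀ {τ} → τ ≤C τ
    transC : ∀ {τ τ' τ''} → τ ≤C τ' → τ' ≤C τ'' → τ ≤C τ''
    topC   : ∀ {τ} → τ ≤C ωC
    monoC  : ∀ {τ₁ τ₂ τ₁' τ₂'} → τ₁ ≤C τ₁' → τ₂ ≤C τ₂' → τ₁ ∧C τ₂ ≤C τ₁' ∧C τ₂'
    idemC₁ : ∀ {τ} → τ ∧C τ ≤C τ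
    idemC₂ : ∀ {τ} → τ ≤C τ ∧C τ
    commC  : ∀ {τ τ'} → τ ∧C τ' ≤C τ' ∧C τ
    lbC    : ∀ {τ τ'} → τ ∧C τ' ≤C τ
    glbC   : ∀ {τ τ' τ''} → τ ≤C τ' → τ ≤C τ'' → τ ≤C τ' ∧C τ''
    T∧     : ∀ {δ δ'} → T δ ∧C T δ' ≤C T (δ ∧V δ')
    Tmono  : ∀ {δ δ'} → δ ≤V δ' → T δ ≤C T δ'

-- Bases: finite partial maps from variables (indices) to value types.
-- Position i of the list holds the assumption for index i (nothing = none);
-- indices beyond the length are unassigned.  Variables are distinct by
-- construction.

Basis : Set
Basis = List (Maybe VType)

infix 4 _∋_∶_

data _∋_∶_ : Basis → ℕ → VType → Set where
  here  : ∀ {Γ δ} → (just δ ∷ Γ) ∋ zero ∶ δ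
  there : ∀ {Γ m x δ} → Γ ∋ x ∶ δ → (m ∷ Γ) ∋ suc x ∶ δ

infix 3 _⊢v_∶_ _⊢c_∶_

mutual
  data _⊢v_∶_ : Basis → Val → VType → Set where
    ax   : ∀ {Γ x δ} → Γ ∋ x ∶ δ → Γ ⊢v var x ∶ δ
    ⇒I   : ∀ {Γ M δ τ} → (just δ ∷ Γ) ⊢c M ∶ τ → Γ ⊢v lam M ∶ δ ⇒ τ
    ωIv  : ∀ {Γ V} → Γ ⊢v V ∶ ωV
    ∧Iv  : ∀ {Γ V δ δ'} → Γ ⊢v V ∶ δ → Γ ⊢v V ∶ δ' → Γ ⊢v V ∶ δ ∧V δ'
    ≤v   : ∀ {Γ V δ δ'} → Γ ⊢v V ∶ δ → δ ≤V δ' → Γ ⊢v V ∶ δ'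

  data _⊢c_∶_ : Basis → Comp → CType → Set where
    unitI : ∀ {Γ V δ} → Γ ⊢v V ∶ δ → Γ ⊢c unit V ∶ T δ
    ⇒E    : ∀ {Γ M V δ τ} → Γ ⊢c M ∶ T δ → Γ ⊢v V ∶ δ ⇒ τ → Γ ⊢c M ⋆ V ∶ τ
    ωIc   : ∀ {Γ M} → Γ ⊢c M ∶ ωC
    ∧Ic   : ∀ {Γ M τ τ'} → Γ ⊢c M ∶ τ → Γ ⊢c M ∶ τ' → Γ ⊢c M ∶ τ ∧C τ'
    ≤c    : ∀ {Γ M τ τ'} → Γ ⊢c M ∶ τ → τ ≤C τ' → Γ ⊢c M ∶ τ'

-- The crux is a generation lemma for each term former: what a typing of λx.M,
-- unit V or M ⋆ V says about its parts.  Since derivations may end with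
-- subsumption, each is proved by reading a type as a property of the subterm
-- (for λx.M: the typings of M that its arrow conjuncts promise; for unit V:
-- the value type under the T's) and checking that this property is monotone
-- in ≤.  The redexes are then handled by the substitution lemma (β), by
-- inverting the identity abstraction (η), and by weakening (associativity),
-- where ⋆-generation applies because ω_C lies below no T δ.

module Submission where

open import Defs
open import Data.Nat using (ℕ; zero; suc)
open import Data.List using (_∷_)
open import Data.Maybe using (just)
open import Data.Unit using (⊤; tt)
open import Data.Empty using (⊥; ⊥-elim)
open import Data.Sum using (_⊎_; inj₁; inj₂)
open import Data.Product using (∃-syntax; _×_; _,_)
open import Relation.Nullary using (¬_)
open import Relation.Binary.PropositionalEquality using (_≡_; refl; cong; cong₂; subst)

Renaming : (ℕ → ℕ) → Basis → Basis → Set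
Renaming ρ Γ Δ = ∀ {x δ} → Γ ∋ x ∶ δ → Δ ∋ ρ x ∶ δ

rename-ext : ∀ {ρ Γ Δ m} → Renaming ρ Γ Δ → Renaming (ext ρ) (m ∷ Γ) (m ∷ Δ)
rename-ext h here      = here
rename-ext h (there p) = there (h p)

mutual
  renameV : ∀ {ρ Γ Δ V δ} → Renaming ρ Γ Δ → Γ ⊢v V ∶ δ → Δ ⊢v renV ρ V ∶ δ
  renameV h (ax p)    = ax (h p)
  renameV h (⇒I d)    = ⇒I (renameC (rename-ext h) d)
  renameV h ωIv       = ωIv
  renameV h (∧Iv d e) = ∧Iv (renameV h d) (renameV h e)
  renameV h (≤v d l)  = ≤v (renameV h d) l

  renameC : ∀ {ρ Γ Δ M τ} → Renaming ρ Γ Δ → Γ ⊢c M ∶ τ → Δ ⊢c renC ρ M ∶ τ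
  renameC h (unitI d) = unitI (renameV h d)
  renameC h (⇒E d e)  = ⇒E (renameC h d) (renameV h e)
  renameC h ωIc       = ωIc
  renameC h (∧Ic d e) = ∧Ic (renameC h d) (renameC h e)
  renameC h (≤c d l)  = ≤c (renameC h d) l

Substitution : (ℕ → Val) → Basis → Basis → Set
Substitution σ Γ Δ = ∀ {x δ} → Γ ∋ x ∶ δ → Δ ⊢v σ x ∶ δ

subst-ext : ∀ {σ Γ Δ δ} → Substitution σ Γ Δ →
            Substitution (exts σ) (just δ ∷ Γ) (just δ ∷ Δ)
subst-ext h here      = ax here
subst-ext h (there p) = renameV there (h p)

mutual
  substV : ∀ {σ Γ Δ V δ} → Substitution σ Γ Δ → Γ ⊢v V ∶ δ → Δ ⊢v subV σ V ∶ δ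
  substV h (ax p)    = h p
  substV h (⇒I d)    = ⇒I (substC (subst-ext h) d)
  substV h ωIv       = ωIv
  substV h (∧Iv d e) = ∧Iv (substV h d) (substV h e)
  substV h (≤v d l)  = ≤v (substV h d) l

  substC : ∀ {σ Γ Δ M τ} → Substitution σ Γ Δ → Γ ⊢c M ∶ τ → Δ ⊢c subC σ M ∶ τ
  substC h (unitI d) = unitI (substV h d)
  substC h (⇒E d e)  = ⇒E (substC h d) (substV h e)
  substC h ωIc       = ωIc
  substC h (∧Ic d e) = ∧Ic (substC h d) (substC h e)
  substC h (≤c d l)  = ≤c (substC h d) l

subst-single : ∀ {Γ V δ} → Γ ⊢v V ∶ δ → Substitution (single V) (just δ ∷ Γ) Γ
subst-single d here      = d
subst-single d (there p) = ax p

IdentityOn : (ℕ → Val) → Set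
IdentityOn σ = ∀ x → σ x ≡ var x

exts-identity : ∀ {σ} → IdentityOn σ → IdentityOn (exts σ)
exts-identity h zero    = refl
exts-identity h (suc x) = cong (renV suc) (h x)

mutual
  subV-identity : ∀ {σ} → IdentityOn σ → ∀ V → subV σ V ≡ V
  subV-identity h (var x) = h x
  subV-identity h (lam M) = cong lam (subC-identity (exts-identity h) M)

  subC-identity : ∀ {σ} → IdentityOn σ → ∀ M → subC σ M ≡ M
  subC-identity h (unit V) = cong unit (subV-identity h V)
  subC-identity h (M ⋆ V)  = cong₂ _⋆_ (subC-identity h M) (subV-identity h V)

-- Narrowing an assumption is the substitution of each variable for itself.
narrow-head : ∀ {Γ M δ δ' τ} → δ' ≤V δ →
              just δ ∷ Γ ⊢c M ∶ τ → just δ' ∷ Γ ⊢c M ∶ τ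
narrow-head {Γ} {M} {δ} {δ'} {τ} l d =
  subst (λ M' → just δ' ∷ Γ ⊢c M' ∶ τ) (subC-identity (λ _ → refl) M)
        (substC var-typed d)
  where
  var-typed : Substitution var (just δ ∷ Γ) (just δ' ∷ Γ)
  var-typed here      = ≤v (ax here) l
  var-typed (there p) = ax (there p)

∋-functional : ∀ {Γ x δ δ'} → Γ ∋ x ∶ δ → Γ ∋ x ∶ δ' → δ ≡ δ'
∋-functional here      here      = refl
∋-functional (there p) (there q) = ∋-functional p q

var-inv : ∀ {Γ x δ δ'} → Γ ∋ x ∶ δ → Γ ⊢v var x ∶ δ' → δ ≤V δ'
var-inv p (ax q) with ∋-functional p q
... | refl = reflV
var-inv p ωIv       = topV
var-inv p (∧Iv d e) = glbV (var-inv p d) (var-inv p e)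
var-inv p (≤v d l)  = transV (var-inv p d) l

LamBody : Basis → Comp → VType → Set
LamBody Γ M (tvar _) = ⊤
LamBody Γ M (δ ⇒ τ)  = just δ ∷ Γ ⊢c M ∶ τ
LamBody Γ M (δ ∧V δ') = LamBody Γ M δ × LamBody Γ M δ'
LamBody Γ M ωV       = ⊤

LamBody-mono : ∀ {Γ M δ δ'} → δ ≤V δ' → LamBody Γ M δ → LamBody Γ M δ'
LamBody-mono reflV          b        = b
LamBody-mono (transV l l')  b        = LamBody-mono l' (LamBody-mono l b)
LamBody-mono topV           b        = tt
LamBody-mono (monoV l l')   (b , b') = LamBody-mono l b , LamBody-mono l' b'
LamBody-mono idemV₁         (b , _)  = b
LamBody-mono idemV₂         b        = b , b
LamBody-mono commV          (b , b') = b' , b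
LamBody-mono lbV            (b , _)  = b
LamBody-mono (glbV l l')    b        = LamBody-mono l b , LamBody-mono l' b
LamBody-mono ω⇒             b        = ωIc
LamBody-mono ⇒∧             (b , b') = ∧Ic b b'
LamBody-mono (⇒mono l l')   b        = ≤c (narrow-head l b) l'

lam-gen : ∀ {Γ M δ} → Γ ⊢v lam M ∶ δ → LamBody Γ M δ
lam-gen (⇒I d)    = d
lam-gen ωIv       = tt
lam-gen (∧Iv d e) = lam-gen d , lam-gen e
lam-gen (≤v d l)  = LamBody-mono l (lam-gen d)

lam-inv : ∀ {Γ M δ τ} → Γ ⊢v lam M ∶ δ ⇒ τ → just δ ∷ Γ ⊢c M ∶ τ
lam-inv = lam-gen

T⁻¹ : CType → VType
T⁻¹ (T δ)     = δ
T⁻¹ (τ ∧C τ') = T⁻¹ τ ∧V T⁻¹ τ'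
T⁻¹ ωC        = ωV

T⁻¹-mono : ∀ {τ τ'} → τ ≤C τ' → T⁻¹ τ ≤V T⁻¹ τ'
T⁻¹-mono reflC         = reflV
T⁻¹-mono (transC l l') = transV (T⁻¹-mono l) (T⁻¹-mono l')
T⁻¹-mono topC          = topV
T⁻¹-mono (monoC l l')  = monoV (T⁻¹-mono l) (T⁻¹-mono l')
T⁻¹-mono idemC₁        = idemV₁
T⁻¹-mono idemC₂        = idemV₂
T⁻¹-mono commC         = commV
T⁻¹-mono lbC           = lbV
T⁻¹-mono (glbC l l')   = glbV (T⁻¹-mono l) (T⁻¹-mono l')
T⁻¹-mono T∧            = reflV
T⁻¹-mono (Tmono l)     = l

unit-gen : ∀ {Γ V τ} → Γ ⊢c unit V ∶ τ → Γ ⊢v V ∶ T⁻¹ τ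
unit-gen (unitI d)  = d
unit-gen ωIc        = ωIv
unit-gen (∧Ic d e)  = ∧Iv (unit-gen d) (unit-gen e)
unit-gen (≤c d l)   = ≤v (unit-gen d) (T⁻¹-mono l)

unit-var-gen : ∀ {Γ x δ τ} → Γ ∋ x ∶ δ → Γ ⊢c unit (var x) ∶ τ → T δ ≤C τ
unit-var-gen p (unitI d) = Tmono (var-inv p d)
unit-var-gen p ωIc       = topC
unit-var-gen p (∧Ic d e) = glbC (unit-var-gen p d) (unit-var-gen p e)
unit-var-gen p (≤c d l)  = transC (unit-var-gen p d) l

HasT : CType → Set
HasT (T _)     = ⊤
HasT (τ ∧C τ') = HasT τ ⊎ HasT τ'
HasT ωC        = ⊥

HasT-antitone : ∀ {τ τ'} → τ ≤C τ' → HasT τ' → HasT τ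
HasT-antitone reflC         h        = h
HasT-antitone (transC l l') h        = HasT-antitone l (HasT-antitone l' h)
HasT-antitone topC          ()
HasT-antitone (monoC l l')  (inj₁ h) = inj₁ (HasT-antitone l h)
HasT-antitone (monoC l l')  (inj₂ h) = inj₂ (HasT-antitone l' h)
HasT-antitone idemC₁        h        = inj₁ h
HasT-antitone idemC₂        (inj₁ h) = h
HasT-antitone idemC₂        (inj₂ h) = h
HasT-antitone commC         (inj₁ h) = inj₂ h
HasT-antitone commC         (inj₂ h) = inj₁ h
HasT-antitone lbC           h        = inj₁ h
HasT-antitone (glbC l l')   (inj₁ h) = HasT-antitone l h
HasT-antitone (glbC l l')   (inj₂ h) = HasT-antitone l' h
HasT-antitone T∧            h        = inj₁ tt
HasT-antitone (Tmono l)     h        = tt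

ωC≰T : ∀ {δ} → ¬ (ωC ≤C T δ)
ωC≰T l = HasT-antitone l tt

⋆-gen : ∀ {Γ M V τ} → Γ ⊢c M ⋆ V ∶ τ →
        ωC ≤C τ ⊎ ∃[ δ ] (Γ ⊢c M ∶ T δ × Γ ⊢v V ∶ δ ⇒ τ)
⋆-gen (⇒E d e) = inj₂ (_ , d , e)
⋆-gen ωIc      = inj₁ reflC
⋆-gen (≤c d l) with ⋆-gen d
... | inj₁ w           = inj₁ (transC w l)
... | inj₂ (δ , m , v) = inj₂ (δ , m , ≤v v (⇒mono reflV l))
⋆-gen (∧Ic d e) with ⋆-gen d | ⋆-gen e
... | inj₁ w | inj₁ w' = inj₁ (glbC w w')
... | inj₁ w | inj₂ (δ , m , v) =
  inj₂ (δ , m , ≤v v (⇒mono reflV (glbC (transC topC w) reflC)))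
... | inj₂ (δ , m , v) | inj₁ w' =
  inj₂ (δ , m , ≤v v (⇒mono reflV (glbC reflC (transC topC w'))))
... | inj₂ (δ₁ , m₁ , v₁) | inj₂ (δ₂ , m₂ , v₂) =
  inj₂ (δ₁ ∧V δ₂ , ≤c (∧Ic m₁ m₂) T∧ ,
        ≤v (∧Iv (≤v v₁ (⇒mono lbV reflC))
                (≤v v₂ (⇒mono (transV commV lbV) reflC))) ⇒∧)

⋆-inv : ∀ {Γ M V δ} → Γ ⊢c M ⋆ V ∶ T δ →
        ∃[ δ' ] (Γ ⊢c M ∶ T δ' × Γ ⊢v V ∶ δ' ⇒ T δ)
⋆-inv d with ⋆-gen d
... | inj₁ w = ⊥-elim (ωC≰T w)
... | inj₂ g = g

β-preserves : ∀ {Γ V M δ τ} → Γ ⊢c unit V ∶ T δ → Γ ⊢v lam M ∶ δ ⇒ τ →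
              Γ ⊢c M [ V ] ∶ τ
β-preserves d e = substC (subst-single (unit-gen d)) (lam-inv e)

η-preserves : ∀ {Γ M δ τ} → Γ ⊢c M ∶ T δ → Γ ⊢v lam (unit (var zero)) ∶ δ ⇒ τ →
              Γ ⊢c M ∶ τ
η-preserves d e = ≤c d (unit-var-gen here (lam-inv e))

assoc-preserves : ∀ {Γ L M N δ τ} →
                  Γ ⊢c L ⋆ lam M ∶ T δ → Γ ⊢v lam N ∶ δ ⇒ τ →
                  Γ ⊢c L ⋆ lam (M ⋆ lam (renC (ext suc) N)) ∶ τ
assoc-preserves d e with ⋆-inv d
... | _ , dL , dM = ⇒E dL (⇒I (⇒E (lam-inv dM) (renameV there e)))

mutual
  subject-reductionV : ∀ {Γ V V' δ} → Γ ⊢v V ∶ δ → V ⟶v V' → Γ ⊢v V' ∶ δ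
  subject-reductionV (⇒I d)    (ξlam r) = ⇒I (subject-reduction d r)
  subject-reductionV ωIv       r        = ωIv
  subject-reductionV (∧Iv d e) r        = ∧Iv (subject-reductionV d r) (subject-reductionV e r)
  subject-reductionV (≤v d l)  r        = ≤v (subject-reductionV d r) l

  subject-reduction : ∀ {Γ M N τ} → Γ ⊢c M ∶ τ → M ⟶ N → Γ ⊢c N ∶ τ
  subject-reduction ωIc       r         = ωIc
  subject-reduction (∧Ic d e) r         = ∧Ic (subject-reduction d r) (subject-reduction e r)
  subject-reduction (≤c d l)  r         = ≤c (subject-reduction d r) l
  subject-reduction (unitI d) (ξunit r) = unitI (subject-reductionV d r)
  subject-reduction (⇒E d e)  β         = β-preserves d e
  subject-reduction (⇒E d e)  η         = η-preserves d e
  subject-reduction (⇒E d e)  assoc     = assoc-preserves d e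
  subject-reduction (⇒E d e)  (ξ⋆ˡ r)   = ⇒E (subject-reduction d r) e
  subject-reduction (⇒E d e)  (ξ⋆ʳ r)   = ⇒E d (subject-reductionV e r)

mainTheorem3 : (Γ : Basis) (M N : Comp) (τ : CType) →
    Γ ⊢c M ∶ τ → M ⟶ N → Γ ⊢c N ∶ τ
mainTheorem3 Γ M N τ d r = subject-reduction d r
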